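{- An Arnoux--Rauzy word over a finite alphabet $\mathcal{A}$ with bounded weak partial quotients is $P$-power-free for some $P\ge0$.
   Context: Let $|\mathcal{A}|=d\ge2$. For $a\in\mathcal{A}$, $\sigma_a$ maps $a\mapsto a$ and $b\mapsto ba$ for $b\ne a$. An Arnoux--Rauzy word is a recurrent infinite word over $\mathcal{A}$ with $(d-1)n+1$ factors of each length $n$ and exactly one left special and one right special factor of each length; equivalently its set of factors coincides with that of $\lim_n\sigma_{a_0}\circ\cdots\circ\sigma_{a_n}(a)$ for a letter $a$ and a directive sequence $(a_n)$ in which every letter occurs infinitely often. Writing $a_0a_1\cdots=b_0^{k_0}b_1^{k_1}\cdots$ with $b_j\ne b_{j+1}$, $k_j\ge1$, the $k_j$ are the weak partial quotients. $P$-power-free means no factor $z^P$ with $z$ nonempty. -}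

module Defs where

open import Data.Nat using (ℕ; zero; suc; _+_; _≤_)
open import Data.Fin using (Fin; _≟_)
open import Data.List using (List; []; _∷_; concatMap; concat; replicate; length)
open import Data.Product using (Σ; ∃; _×_)
open import Relation.Binary.PropositionalEquality using (_≡_; _≢_)
open import Relation.Nullary using (¬_; yes; no)

InfWord : ℕ → Set
InfWord d = ℕ → Fin d

σ-letter : ∀ {d} → Fin d → Fin d → List (Fin d)
σ-letter a b with b ≟ a
... | yes _ = a ∷ []
... | no _  = b ∷ a ∷ []

σ : ∀ {d} → Fin d → List (Fin d) → List (Fin d)
σ a = concatMap (σ-letter a)

-- σ-comp dir n w = σ_{dir 0} ∘ σ_{dir 1} ∘ ⋯ ∘ σ_{dir n} (w)
σ-comp : ∀ {d} → (ℕ → Fin d) → ℕ → List (Fin d) → List (Fin d)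
σ-comp dir zero w = σ (dir 0) w
σ-comp dir (suc n) w = σ (dir 0) (σ-comp (λ k → dir (suc k)) n w)

take : ∀ {d} → ℕ → InfWord d → List (Fin d)
take zero x = []
take (suc n) x = x 0 ∷ take n (λ k → x (suc k))

IsPrefix : ∀ {d} → List (Fin d) → InfWord d → Set
IsPrefix u x = take (length u) x ≡ u

IsFactor : ∀ {d} → List (Fin d) → InfWord d → Set
IsFactor u x = ∃ λ i → take (length u) (λ j → x (i + j)) ≡ u

EveryLetterInfinitelyOften : ∀ {d} → (ℕ → Fin d) → Set
EveryLetterInfinitelyOften {d} dir = (b : Fin d) (n : ℕ) → ∃ λ m → n ≤ m × dir m ≡ b

-- y = lim_n σ_{a_0} ∘ ⋯ ∘ σ_{a_n}(a) : every σ-comp dir n [a] is a prefix of y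
IsLimitWord : ∀ {d} → (ℕ → Fin d) → Fin d → InfWord d → Set
IsLimitWord dir a y = (n : ℕ) → IsPrefix (σ-comp dir n (a ∷ [])) y

IsArnouxRauzyWithDirective : ∀ {d} → InfWord d → (ℕ → Fin d) → Set
IsArnouxRauzyWithDirective {d} x dir =
  EveryLetterInfinitelyOften dir ×
  Σ (Fin d) λ a → Σ (InfWord d) λ y →
    IsLimitWord dir a y × ((u : List (Fin d)) → (IsFactor u x → IsFactor u y) × (IsFactor u y → IsFactor u x))

-- Weak partial quotients of dir (lengths of maximal runs of equal letters)
-- are all ≤ K: equivalently no K+1 consecutive equal letters.
WeakPartialQuotientsBoundedBy : ∀ {d} → (ℕ → Fin d) → ℕ → Set
WeakPartialQuotientsBoundedBy dir K =
  (n : ℕ) → ¬ ((i : ℕ) → i ≤ K → dir (n + i) ≡ dir n)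

pow : ∀ {A : Set} → List A → ℕ → List A
pow z P = concat (replicate P z)

PowerFree : ∀ {d} → ℕ → InfWord d → Set
PowerFree P x = ∀ z → z ≢ [] → ¬ IsFactor (pow z P) x

{-# OPTIONS --safe #-}
-- Write y = σ_{a_0}(y_1), y_1 = σ_{a_1}(y_2), …  A factor of y_n of length L with period p, L > 2p,
-- desubstitutes, after cutting off at most one leading letter a_n, to a strictly shorter factor of y_{n+1}
-- whose period is the preimage of the old one.  Measure every level in letters of y, i.e. give c the weight
-- ℓ_n(c) = |σ_{a_0}⋯σ_{a_{n-1}}(c)|: the weight of the period is preserved, and the weight Λ_n cut off down
-- to level n stays below (K + 2) min_c ℓ_n(c) when the directive sequence has no run longer than K.  Once
-- L ≤ 2p the factor weighs at most twice its period, so every factor of y with period p has length at most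
-- (K + 4) p, and y, hence x, is (K + 5)-power-free.
module Submission where

open import Defs
open import Data.Nat using (ℕ; zero; suc; _+_; _*_; _∸_; _≤_; _<_; _≥_; z≤n; s≤s; s≤s⁻¹; _≤?_)
open import Data.Nat.Properties hiding (_≟_)
open import Data.Nat.Induction using (<-wellFounded)
open import Data.Fin using (Fin; _≟_)
import Data.Fin as Fin
open import Data.Fin.Properties using (punchInᵢ≢i)
open import Data.List using (List; []; _∷_; _++_; length)
open import Data.List.Properties using (∷-injective; ∷-injectiveˡ; ∷-injectiveʳ; ++-assoc; ++-identityʳ; length-++)
open import Data.Product using (∃; _×_; _,_; proj₁; proj₂)
open import Data.Sum using (_⊎_; inj₁; inj₂)
open import Data.Empty using (⊥-elim)
open import Induction.WellFounded using (Acc; acc)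
open import Relation.Binary.PropositionalEquality
open import Relation.Nullary using (¬_; Dec; yes; no)

crossing : ∀ (f : ℕ → ℕ) {T n} → f 0 < T → T ≤ f n → ∃ λ m → f m < T × T ≤ f (suc m)
crossing f {n = zero}      f0<T T≤f0 = ⊥-elim (<⇒≱ f0<T T≤f0)
crossing f {T} {suc n} f0<T T≤f1+n with T ≤? f n
... | yes T≤fn = crossing f f0<T T≤fn
... | no  T≰fn = n , ≰⇒> T≰fn , T≤f1+n

drop : ∀ {A : Set} → ℕ → (ℕ → A) → ℕ → A
drop i Y j = Y (i + j)

module _ {d : ℕ} where

  take-cong : ∀ n {Y Y′ : InfWord d} → (∀ j → Y j ≡ Y′ j) → take n Y ≡ take n Y′
  take-cong zero    Y≗Y′ = refl
  take-cong (suc n) Y≗Y′ = cong₂ _∷_ (Y≗Y′ 0) (take-cong n (λ j → Y≗Y′ (suc j)))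

  take-injective-< : ∀ n {Y Y′ : InfWord d} → take n Y ≡ take n Y′ → ∀ {t} → t < n → Y t ≡ Y′ t
  take-injective-< (suc n) eq {zero}  _         = ∷-injectiveˡ eq
  take-injective-< (suc n) eq {suc t} (s≤s t<n) = take-injective-< n (∷-injectiveʳ eq) t<n

  IsPrefix-agree : ∀ {u : List (Fin d)} {Y Y′} → IsPrefix u Y → IsPrefix u Y′ → ∀ {t} → t < length u → Y t ≡ Y′ t
  IsPrefix-agree {u} u⊑Y u⊑Y′ = take-injective-< (length u) (trans u⊑Y (sym u⊑Y′))

  IsPrefix-++⁻ : ∀ (u : List (Fin d)) {v Y} → IsPrefix (u ++ v) Y → IsPrefix u Y × IsPrefix v (drop (length u) Y)
  IsPrefix-++⁻ []      uv⊑Y = refl , uv⊑Y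
  IsPrefix-++⁻ (c ∷ u) uv⊑Y with ∷-injective uv⊑Y
  ... | Y0≡c , uv⊑Y′ with IsPrefix-++⁻ u uv⊑Y′
  ...   | u⊑Y′ , v⊑ = cong₂ _∷_ Y0≡c u⊑Y′ , v⊑

factorWeight : ∀ {d} → (Fin d → ℕ) → InfWord d → ℕ → ℕ → ℕ
factorWeight ℓ Y i zero    = 0
factorWeight ℓ Y i (suc n) = ℓ (Y i) + factorWeight ℓ Y (suc i) n

HasPeriod : ∀ {A : Set} → ℕ → (ℕ → A) → ℕ → ℕ → Set
HasPeriod p Y s e = ∀ {x} → s ≤ x → x + p < e → Y x ≡ Y (x + p)

hasPeriod-intro : ∀ {A : Set} {p} {Y : ℕ → A} i L → (∀ {t} → t + p < L → Y (i + t) ≡ Y (i + t + p)) → HasPeriod p Y i (i + L)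
hasPeriod-intro {p = p} i L per {x} i≤x x+p<i+L with m≤n⇒∃[o]m+o≡n i≤x
... | t , refl = per (+-cancelˡ-< i (t + p) L (subst (_< i + L) (+-assoc i t p) x+p<i+L))

module _ {d : ℕ} (ℓ : Fin d → ℕ) (Y : InfWord d) where

  factorWeight-+ : ∀ i m n → factorWeight ℓ Y i (m + n) ≡ factorWeight ℓ Y i m + factorWeight ℓ Y (i + m) n
  factorWeight-+ i zero    n = cong (λ s → factorWeight ℓ Y s n) (sym (+-identityʳ i))
  factorWeight-+ i (suc m) n = begin
    ℓ (Y i) + factorWeight ℓ Y (suc i) (m + n)
      ≡⟨ cong (ℓ (Y i) +_) (factorWeight-+ (suc i) m n) ⟩
    ℓ (Y i) + (factorWeight ℓ Y (suc i) m + factorWeight ℓ Y (suc i + m) n)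
      ≡⟨ +-assoc (ℓ (Y i)) _ _ ⟨
    factorWeight ℓ Y i (suc m) + factorWeight ℓ Y (suc (i + m)) n
      ≡⟨ cong (λ s → factorWeight ℓ Y i (suc m) + factorWeight ℓ Y s n) (+-suc i m) ⟨
    factorWeight ℓ Y i (suc m) + factorWeight ℓ Y (i + suc m) n ∎
    where open ≡-Reasoning

  factorWeight-mono-≤ : ∀ i {m n} → m ≤ n → factorWeight ℓ Y i m ≤ factorWeight ℓ Y i n
  factorWeight-mono-≤ i {m} m≤n with m≤n⇒∃[o]m+o≡n m≤n
  ... | o , refl = ≤-trans (m≤m+n _ _) (≤-reflexive (sym (factorWeight-+ i m o)))

  factorWeight-head : ∀ i {n} → 1 ≤ n → ℓ (Y i) ≤ factorWeight ℓ Y i n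
  factorWeight-head i {suc n} _ = m≤m+n _ _

  factorWeight-cong : ∀ n {i j} → (∀ {t} → t < n → Y (i + t) ≡ Y (j + t)) → factorWeight ℓ Y i n ≡ factorWeight ℓ Y j n
  factorWeight-cong zero    _    = refl
  factorWeight-cong (suc n) {i} {j} agree = cong₂ _+_ (cong ℓ first) (factorWeight-cong n rest)
    where
    first : Y i ≡ Y j
    first = subst₂ (λ x y → Y x ≡ Y y) (+-identityʳ i) (+-identityʳ j) (agree (s≤s z≤n))
    rest : ∀ {t} → t < n → Y (suc i + t) ≡ Y (suc j + t)
    rest {t} t<n = subst₂ (λ x y → Y x ≡ Y y) (+-suc i t) (+-suc j t) (agree (s≤s t<n))

  factorWeight-rotate : ∀ {i p} → Y i ≡ Y (i + p) → factorWeight ℓ Y (suc i) p ≡ factorWeight ℓ Y i p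
  factorWeight-rotate {i} {p} Yi≡Yi+p = +-cancelˡ-≡ (ℓ (Y i)) _ _ (begin
    factorWeight ℓ Y i (suc p)           ≡⟨ cong (factorWeight ℓ Y i) (+-comm 1 p) ⟩
    factorWeight ℓ Y i (p + 1)           ≡⟨ factorWeight-+ i p 1 ⟩
    factorWeight ℓ Y i p + (ℓ (Y (i + p)) + 0)
                                         ≡⟨ cong (factorWeight ℓ Y i p +_) (trans (+-identityʳ _) (cong ℓ (sym Yi≡Yi+p))) ⟩
    factorWeight ℓ Y i p + ℓ (Y i)       ≡⟨ +-comm _ (ℓ (Y i)) ⟩
    ℓ (Y i) + factorWeight ℓ Y i p       ∎)
    where open ≡-Reasoning

  factorWeight-≤-2* : ∀ {i p L} → HasPeriod p Y i (i + L) → p ≤ L → L ≤ p + p → factorWeight ℓ Y i L ≤ 2 * factorWeight ℓ Y i p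
  factorWeight-≤-2* {i} {p} per p≤L L≤2p with m≤n⇒∃[o]m+o≡n p≤L
  ... | q , refl = begin
    factorWeight ℓ Y i (p + q)                            ≡⟨ factorWeight-+ i p q ⟩
    factorWeight ℓ Y i p + factorWeight ℓ Y (i + p) q     ≡⟨ cong (factorWeight ℓ Y i p +_) (factorWeight-cong q shifted) ⟩
    factorWeight ℓ Y i p + factorWeight ℓ Y i q           ≤⟨ +-monoʳ-≤ _ (factorWeight-mono-≤ i (+-cancelˡ-≤ p q p L≤2p)) ⟩
    factorWeight ℓ Y i p + factorWeight ℓ Y i p           ≡⟨ cong (factorWeight ℓ Y i p +_) (+-identityʳ _) ⟨
    2 * factorWeight ℓ Y i p                              ∎
    where
    open ≤-Reasoning
    shifted : ∀ {t} → t < q → Y (i + p + t) ≡ Y (i + t)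
    shifted {t} t<q = trans (cong Y (trans (+-assoc i p t) (cong (i +_) (+-comm p t))))
                            (sym (trans (per (m≤m+n i t) i+t+p<i+p+q) (cong Y (+-assoc i t p))))
      where
      i+t+p<i+p+q : i + t + p < i + (p + q)
      i+t+p<i+p+q = subst (_< i + (p + q)) (trans (cong (i +_) (+-comm p t)) (sym (+-assoc i t p)))
                          (+-monoʳ-< i (+-monoʳ-< p t<q))

factorWeight-one : ∀ {d} (Y : InfWord d) i n → factorWeight (λ _ → 1) Y i n ≡ n
factorWeight-one Y i zero    = refl
factorWeight-one Y i (suc n) = cong suc (factorWeight-one Y (suc i) n)

blockLength : ∀ {d} → Fin d → Fin d → ℕ
blockLength b c = length (σ-letter b c)

-- imageWeight b ℓ c is the ℓ-weight of σ_b(c).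
imageWeight : ∀ {d} → Fin d → (Fin d → ℕ) → Fin d → ℕ
imageWeight b ℓ c with c ≟ b
... | yes _ = ℓ c
... | no  _ = ℓ c + ℓ b

-- Characterises Y ∈ σ_b(A^ℕ).
Desubstitutable : ∀ {d} → Fin d → InfWord d → Set
Desubstitutable b Y = ∀ {x} → Y x ≢ b → Y (suc x) ≡ b

module _ {d : ℕ} {b : Fin d} where

  blockLength-≡ : ∀ {c} → c ≡ b → blockLength b c ≡ 1
  blockLength-≡ {c} c≡b with c ≟ b
  ... | yes _   = refl
  ... | no  c≢b = ⊥-elim (c≢b c≡b)

  blockLength-≢ : ∀ {c} → c ≢ b → blockLength b c ≡ 2
  blockLength-≢ {c} c≢b with c ≟ b
  ... | yes c≡b = ⊥-elim (c≢b c≡b)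
  ... | no  _   = refl

  blockLength>0 : ∀ c → 0 < blockLength b c
  blockLength>0 c with c ≟ b
  ... | yes _ = s≤s z≤n
  ... | no  _ = s≤s z≤n

  imageWeight-≡ : ∀ ℓ → imageWeight b ℓ b ≡ ℓ b
  imageWeight-≡ ℓ with b ≟ b
  ... | yes _   = refl
  ... | no  b≢b = ⊥-elim (b≢b refl)

  imageWeight-≢ : ∀ ℓ {c} → c ≢ b → imageWeight b ℓ c ≡ ℓ c + ℓ b
  imageWeight-≢ ℓ {c} c≢b with c ≟ b
  ... | yes c≡b = ⊥-elim (c≢b c≡b)
  ... | no  _   = refl

  factorWeight-block : ∀ {Y} → Desubstitutable b Y → ∀ ℓ x → factorWeight ℓ Y x (blockLength b (Y x)) ≡ imageWeight b ℓ (Y x)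
  factorWeight-block {Y} followed ℓ x with Y x ≟ b
  ... | yes _   = +-identityʳ (ℓ (Y x))
  ... | no  Yx≢b = cong (ℓ (Y x) +_) (trans (+-identityʳ _) (cong ℓ (followed Yx≢b)))

  σ-head : ∀ c v → ∃ λ r → σ b (c ∷ v) ≡ c ∷ r
  σ-head c v with c ≟ b
  ... | yes refl = σ b v , refl
  ... | no  _    = b ∷ σ b v , refl

  length-σ-≥ : ∀ v → length v ≤ length (σ b v)
  length-σ-≥ []      = z≤n
  length-σ-≥ (c ∷ v) with c ≟ b
  ... | yes _ = s≤s (length-σ-≥ v)
  ... | no  _ = s≤s (m≤n⇒m≤1+n (length-σ-≥ v))

  length-σ-∷ : ∀ {c} v → c ≢ b → 2 + length v ≤ length (σ b (c ∷ v))
  length-σ-∷ {c} v c≢b with c ≟ b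
  ... | yes c≡b = ⊥-elim (c≢b c≡b)
  ... | no  _   = s≤s (s≤s (length-σ-≥ v))

  σ-prefix-followed : ∀ v {Y} → IsPrefix (σ b v) Y → ∀ {x} → suc x < length (σ b v) → Y x ≢ b → Y (suc x) ≡ b
  σ-prefix-followed (c ∷ v) v⊑Y x<     Yx≢b with c ≟ b
  σ-prefix-followed (c ∷ v) v⊑Y {zero}  _ Yx≢b | yes _ = ⊥-elim (Yx≢b (∷-injectiveˡ v⊑Y))
  σ-prefix-followed (c ∷ v) v⊑Y {suc x} (s≤s x<) Yx≢b | yes _ =
    σ-prefix-followed v (∷-injectiveʳ v⊑Y) x< Yx≢b
  σ-prefix-followed (c ∷ v) v⊑Y {zero}        _ Yx≢b | no _ = ∷-injectiveˡ (∷-injectiveʳ v⊑Y)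
  σ-prefix-followed (c ∷ v) v⊑Y {suc zero}    _ Yx≢b | no _ = ⊥-elim (Yx≢b (∷-injectiveˡ (∷-injectiveʳ v⊑Y)))
  σ-prefix-followed (c ∷ v) v⊑Y {suc (suc x)} (s≤s (s≤s x<)) Yx≢b | no _ =
    σ-prefix-followed v (∷-injectiveʳ (∷-injectiveʳ v⊑Y)) x< Yx≢b

-- Parses Y as σ_b(desub): the block σ_b(desub k) starts at position blockStart k of Y.
module Desubstitution {d} (b : Fin d) (Y : InfWord d) where

  blockStart : ℕ → ℕ
  blockStart zero    = 0
  blockStart (suc k) = blockStart k + blockLength b (Y (blockStart k))

  desub : InfWord d
  desub k = Y (blockStart k)

  blockStart-< : ∀ k → blockStart k < blockStart (suc k)
  blockStart-< k = m<m+n (blockStart k) (blockLength>0 {b = b} (Y (blockStart k)))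

  blockStart-+-≥ : ∀ j t → blockStart j + t ≤ blockStart (j + t)
  blockStart-+-≥ j zero    = ≤-reflexive (trans (+-identityʳ _) (cong blockStart (sym (+-identityʳ j))))
  blockStart-+-≥ j (suc t) = begin
    blockStart j + suc t       ≡⟨ +-suc _ t ⟩
    suc (blockStart j + t)     ≤⟨ s≤s (blockStart-+-≥ j t) ⟩
    suc (blockStart (j + t))   ≤⟨ blockStart-< (j + t) ⟩
    blockStart (suc (j + t))   ≡⟨ cong blockStart (+-suc j t) ⟨
    blockStart (j + suc t)     ∎
    where open ≤-Reasoning

  blockStart-mono-≤ : ∀ {j k} → j ≤ k → blockStart j ≤ blockStart k
  blockStart-mono-≤ {j} j≤k with m≤n⇒∃[o]m+o≡n j≤k
  ... | t , refl = ≤-trans (m≤m+n _ t) (blockStart-+-≥ j t)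

  blockStart-cancel-< : ∀ {j k} → blockStart j < blockStart k → j < k
  blockStart-cancel-< φj<φk = ≰⇒> (λ k≤j → <⇒≱ φj<φk (blockStart-mono-≤ k≤j))

  blockStart-+ : ∀ j n → blockStart (j + n) ≡ blockStart j + factorWeight (blockLength b) desub j n
  blockStart-+ j zero    = trans (cong blockStart (+-identityʳ j)) (sym (+-identityʳ _))
  blockStart-+ j (suc n) = trans (cong blockStart (+-suc j n)) (trans (blockStart-+ (suc j) n) (+-assoc (blockStart j) _ _))

  factorWeight-blocks : Desubstitutable b Y → ∀ ℓ j n →
    factorWeight ℓ Y (blockStart j) (factorWeight (blockLength b) desub j n) ≡ factorWeight (imageWeight b ℓ) desub j n
  factorWeight-blocks followed ℓ j zero    = refl
  factorWeight-blocks followed ℓ j (suc n) =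
    trans (factorWeight-+ ℓ Y (blockStart j) (blockLength b (desub j)) _)
          (cong₂ _+_ (factorWeight-block followed ℓ (blockStart j)) (factorWeight-blocks followed ℓ (suc j) n))

  blockStart-offset : ∀ {j k p} → blockStart k ≡ blockStart j + p → 1 ≤ p → ∃ λ p′ → 1 ≤ p′ × blockStart (j + p′) ≡ blockStart j + p
  blockStart-offset {j} {k} φk≡φj+p p≥1 = k ∸ j , m<n⇒0<n∸m j<k , trans (cong blockStart (m+[n∸m]≡n (<⇒≤ j<k))) φk≡φj+p
    where
    j<k : j < k
    j<k = blockStart-cancel-< (subst (blockStart j <_) (sym φk≡φj+p) (m<m+n _ p≥1))

  blockStart-crossing : ∀ j {E} → blockStart j < E → ∃ λ m → blockStart (j + m) < E × E ≤ blockStart (j + suc m)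
  blockStart-crossing j {E} φj<E =
    crossing (λ t → blockStart (j + t)) (subst (_< E) (cong blockStart (sym (+-identityʳ j))) φj<E)
             (≤-trans (m≤n+m E _) (blockStart-+-≥ j E))

  blockStart-or-second : ∀ x → (∃ λ k → blockStart k ≡ x) ⊎ (∃ λ k → suc (blockStart k) ≡ x × Y (blockStart k) ≢ b)
  blockStart-or-second zero = inj₁ (0 , refl)
  blockStart-or-second (suc x) with blockStart-or-second x
  ... | inj₂ (k , refl , Yφk≢b) = inj₁ (suc k , trans (cong (blockStart k +_) (blockLength-≢ Yφk≢b)) (+-comm _ 2))
  ... | inj₁ (k , refl) with Y (blockStart k) ≟ b
  ...   | yes Yφk≡b = inj₁ (suc k , trans (cong (blockStart k +_) (blockLength-≡ Yφk≡b)) (+-comm _ 1))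
  ...   | no  Yφk≢b = inj₂ (k , refl , Yφk≢b)

  blockStart-at-≢ : Desubstitutable b Y → ∀ {x} → Y x ≢ b → ∃ λ k → blockStart k ≡ x
  blockStart-at-≢ followed {x} Yx≢b with blockStart-or-second x
  ... | inj₁ start                 = start
  ... | inj₂ (k , refl , Yφk≢b)    = ⊥-elim (Yx≢b (followed Yφk≢b))

  blockStart-after-≡ : ∀ {x} → Y x ≡ b → ∃ λ k → blockStart k ≡ suc x
  blockStart-after-≡ {x} Yx≡b with blockStart-or-second x
  ... | inj₁ (k , refl)         = suc k , trans (cong (blockStart k +_) (blockLength-≡ Yx≡b)) (+-comm _ 1)
  ... | inj₂ (k , refl , Yφk≢b) = suc k , trans (cong (blockStart k +_) (blockLength-≢ Yφk≢b)) (+-comm _ 2)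

  module _ {p p′ E j m} (per : HasPeriod p Y (blockStart j) E) (φj+p′≡φj+p : blockStart (j + p′) ≡ blockStart j + p)
           (φj+m<E : blockStart (j + m) < E) where

    -- Equal letters at x and x + p begin blocks of equal length, so the boundaries repeat with period p.
    blockStart-period : ∀ t → t + p′ ≤ m → blockStart (j + (t + p′)) ≡ blockStart (j + t) + p
    period-inside : ∀ t → t + p′ ≤ m → blockStart (j + t) + p < E

    blockStart-period zero    _        = trans φj+p′≡φj+p (cong (λ s → blockStart s + p) (sym (+-identityʳ j)))
    blockStart-period (suc t) t+p′<m = begin
      blockStart (j + suc (t + p′))            ≡⟨ cong blockStart (+-suc j (t + p′)) ⟩
      blockStart (suc (j + (t + p′)))          ≡⟨ cong (λ s → s + blockLength b (Y s)) (blockStart-period t t+p′≤m) ⟩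
      x + p + blockLength b (Y (x + p))        ≡⟨ cong (λ c → x + p + blockLength b c) Yx≡Yx+p ⟨
      x + p + blockLength b (Y x)              ≡⟨ +-assoc x p _ ⟩
      x + (p + blockLength b (Y x))            ≡⟨ cong (x +_) (+-comm p _) ⟩
      x + (blockLength b (Y x) + p)            ≡⟨ +-assoc x _ p ⟨
      blockStart (suc (j + t)) + p             ≡⟨ cong (λ s → blockStart s + p) (+-suc j t) ⟨
      blockStart (j + suc t) + p               ∎
      where
      open ≡-Reasoning
      x : ℕ
      x = blockStart (j + t)
      t+p′≤m : t + p′ ≤ m
      t+p′≤m = ≤-trans (n≤1+n _) t+p′<m
      Yx≡Yx+p : Y x ≡ Y (x + p)
      Yx≡Yx+p = per (blockStart-mono-≤ (m≤m+n j t)) (period-inside t t+p′≤m)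

    period-inside t t+p′≤m =
      subst (_< E) (blockStart-period t t+p′≤m) (≤-<-trans (blockStart-mono-≤ (+-monoʳ-≤ j t+p′≤m)) φj+m<E)

    desub-hasPeriod : HasPeriod p′ desub j (j + suc m)
    desub-hasPeriod = hasPeriod-intro {Y = desub} j (suc m) λ {t} t+p′<1+m →
      let t+p′≤m = s≤s⁻¹ t+p′<1+m in
      trans (per (blockStart-mono-≤ (m≤m+n j t)) (period-inside t t+p′≤m))
            (cong Y (trans (sym (blockStart-period t t+p′≤m)) (cong blockStart (sym (+-assoc j t p′)))))

open Desubstitution

record Alignment {d} (b : Fin d) (Y : InfWord d) (i p L : ℕ) : Set where
  field
    start block next : ℕ
    block-start  : blockStart b Y block ≡ start
    next-start   : blockStart b Y next ≡ start + p
    start-≥      : i ≤ start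
    next-<       : start + p < i + L
    second-≥     : 2 + i ≤ blockStart b Y (suc block)
    rotate       : ∀ ℓ → factorWeight ℓ Y start p ≡ factorWeight ℓ Y i p
    loss         : ∀ ℓ {n} → i + L ≤ start + n → factorWeight ℓ Y i L ≤ ℓ b + factorWeight ℓ Y start n

record Descent {d} (b : Fin d) (Y : InfWord d) (i p L : ℕ) : Set where
  field
    origin period width : ℕ
    period≥1      : 1 ≤ period
    period≤width  : period ≤ width
    shorter       : width < L
    periodic      : HasPeriod period (desub b Y) origin (origin + width)
    period-weight : ∀ ℓ → factorWeight (imageWeight b ℓ) (desub b Y) origin period ≡ factorWeight ℓ Y i p
    window-weight : ∀ ℓ → factorWeight ℓ Y i L ≤ ℓ b + factorWeight (imageWeight b ℓ) (desub b Y) origin width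

module _ {d} {b : Fin d} {Y : InfWord d} (followed : Desubstitutable b Y) where

  align-≢ : ∀ {i p L} → Y i ≢ b → Y i ≡ Y (i + p) → p < L → Alignment b Y i p L
  align-≢ {i} {p} {L} Yi≢b Yi≡Yi+p p<L with blockStart-at-≢ b Y followed Yi≢b
                                          | blockStart-at-≢ b Y followed (λ Yi+p≡b → Yi≢b (trans Yi≡Yi+p Yi+p≡b))
  ... | j , φj≡i | k , φk≡i+p = record
    { start = i ; block = j ; next = k
    ; block-start = φj≡i
    ; next-start  = φk≡i+p
    ; start-≥     = ≤-refl
    ; next-<      = +-monoʳ-< i p<L
    ; second-≥    = subst (λ s → 2 + i ≤ s + blockLength b (Y s)) (sym φj≡i)
                          (≤-reflexive (trans (+-comm 2 i) (cong (i +_) (sym (blockLength-≢ Yi≢b)))))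
    ; rotate      = λ ℓ → refl
    ; loss        = λ ℓ {n} i+L≤i+n → ≤-trans (factorWeight-mono-≤ ℓ Y i (+-cancelˡ-≤ i L n i+L≤i+n)) (m≤n+m _ (ℓ b))
    }

  align-≡ : ∀ {i p L} → Y i ≡ b → Y i ≡ Y (i + p) → 2 + p ≤ L → Alignment b Y i p L
  align-≡ {i} {p} {suc L} Yi≡b Yi≡Yi+p 2+p≤L with blockStart-after-≡ b Y Yi≡b
                                              | blockStart-after-≡ b Y (trans (sym Yi≡Yi+p) Yi≡b)
  ... | j , φj≡1+i | k , φk≡1+i+p = record
    { start = suc i ; block = j ; next = k
    ; block-start = φj≡1+i
    ; next-start  = φk≡1+i+p
    ; start-≥     = n≤1+n i
    ; next-<      = subst (_≤ i + suc L) (trans (+-suc i (suc p)) (cong suc (+-suc i p))) (+-monoʳ-≤ i 2+p≤L)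
    ; second-≥    = subst (λ s → suc s ≤ blockStart b Y (suc j)) φj≡1+i (blockStart-< b Y j)
    ; rotate      = λ ℓ → factorWeight-rotate ℓ Y Yi≡Yi+p
    ; loss        = λ ℓ {n} i+L≤1+i+n → +-mono-≤ (≤-reflexive (cong ℓ Yi≡b))
                      (factorWeight-mono-≤ ℓ Y (suc i) (+-cancelˡ-≤ (suc i) L n (subst (_≤ suc i + n) (+-suc i L) i+L≤1+i+n)))
    }

  -- The first block boundary at or after i is i itself if Y i ≢ b and i + 1 if Y i ≡ b, so at most
  -- one letter b is cut off; since Y (i + p) ≡ Y i the same choice puts a boundary at exactly p further.
  align : ∀ {i p L} → 1 ≤ p → p + p < L → HasPeriod p Y i (i + L) → Alignment b Y i p L
  align {i} {p} {L} p≥1 2p<L per = by-cases (Y i ≟ b)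
    where
    p<L : p < L
    p<L = <-≤-trans (m<m+n p p≥1) (<⇒≤ 2p<L)
    Yi≡Yi+p : Y i ≡ Y (i + p)
    Yi≡Yi+p = per ≤-refl (+-monoʳ-< i p<L)
    by-cases : Dec (Y i ≡ b) → Alignment b Y i p L
    by-cases (yes Yi≡b) = align-≡ Yi≡b Yi≡Yi+p (≤-trans (s≤s (m<m+n p p≥1)) 2p<L)
    by-cases (no  Yi≢b) = align-≢ Yi≢b Yi≡Yi+p p<L

  descend-aligned : ∀ {i p L} → 1 ≤ p → HasPeriod p Y i (i + L) → Alignment b Y i p L → Descent b Y i p L
  descend-aligned {i} {p} {L} p≥1 per
    record { block = j ; next = k ; block-start = refl ; next-start = φk≡φj+p ; start-≥ = i≤φj ; next-< = φj+p<E
           ; second-≥ = second-≥ ; rotate = rotate ; loss = loss } = record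
    { origin = j ; period = p′ ; width = suc m
    ; period≥1      = p′≥1
    ; period≤width  = ≤-trans p′≤m (n≤1+n m)
    ; shorter       = width-< (≤-trans p′≥1 p′≤m) φj+m<E
    ; periodic      = desub-hasPeriod b Y per′ φj+p′≡φj+p φj+m<E
    ; period-weight = period-weight
    ; window-weight = λ ℓ → subst (λ w → factorWeight ℓ Y i L ≤ ℓ b + w)
                                  (factorWeight-blocks b Y followed ℓ j (suc m)) (loss ℓ E≤end)
    }
    where
    φj E : ℕ
    φj = blockStart b Y j
    E = i + L

    per′ : HasPeriod p Y φj E
    per′ φj≤x = per (≤-trans i≤φj φj≤x)

    offset : ∃ λ p′ → 1 ≤ p′ × blockStart b Y (j + p′) ≡ φj + p
    offset = blockStart-offset b Y {j} {k} φk≡φj+p p≥1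
    p′ : ℕ
    p′ = proj₁ offset
    p′≥1 : 1 ≤ p′
    p′≥1 = proj₁ (proj₂ offset)
    φj+p′≡φj+p : blockStart b Y (j + p′) ≡ φj + p
    φj+p′≡φj+p = proj₂ (proj₂ offset)

    -- The new window is made of the blocks that start before E; the last one may overshoot E.
    crossed : ∃ λ m → blockStart b Y (j + m) < E × E ≤ blockStart b Y (j + suc m)
    crossed = blockStart-crossing b Y j (≤-<-trans (m≤m+n φj p) φj+p<E)
    m : ℕ
    m = proj₁ crossed
    φj+m<E : blockStart b Y (j + m) < E
    φj+m<E = proj₁ (proj₂ crossed)
    E≤φj+1+m : E ≤ blockStart b Y (j + suc m)
    E≤φj+1+m = proj₂ (proj₂ crossed)

    p′≤m : p′ ≤ m
    p′≤m = s≤s⁻¹ (+-cancelˡ-< j p′ (suc m)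
             (blockStart-cancel-< b Y (subst (_< blockStart b Y (j + suc m)) (sym φj+p′≡φj+p) (<-≤-trans φj+p<E E≤φj+1+m))))

    span-p′ : factorWeight (blockLength b) (desub b Y) j p′ ≡ p
    span-p′ = +-cancelˡ-≡ φj _ _ (trans (sym (blockStart-+ b Y j p′)) φj+p′≡φj+p)

    period-weight : ∀ ℓ → factorWeight (imageWeight b ℓ) (desub b Y) j p′ ≡ factorWeight ℓ Y i p
    period-weight ℓ = begin
      factorWeight (imageWeight b ℓ) (desub b Y) j p′                     ≡⟨ factorWeight-blocks b Y followed ℓ j p′ ⟨
      factorWeight ℓ Y φj (factorWeight (blockLength b) (desub b Y) j p′) ≡⟨ cong (factorWeight ℓ Y φj) span-p′ ⟩
      factorWeight ℓ Y φj p                                               ≡⟨ rotate ℓ ⟩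
      factorWeight ℓ Y i p                                                ∎
      where open ≡-Reasoning

    E≤end : E ≤ φj + factorWeight (blockLength b) (desub b Y) j (suc m)
    E≤end = subst (E ≤_) (blockStart-+ b Y j (suc m)) E≤φj+1+m

    width-< : ∀ {m} → 1 ≤ m → blockStart b Y (j + m) < E → suc m < L
    width-< {suc m₀} _ φj+m<E = +-cancelˡ-< i (suc (suc m₀)) L (begin-strict
      i + suc (suc m₀)               ≡⟨ trans (+-suc i (suc m₀)) (cong suc (+-suc i m₀)) ⟩
      2 + i + m₀                     ≤⟨ +-monoˡ-≤ m₀ second-≥ ⟩
      blockStart b Y (suc j) + m₀    ≤⟨ blockStart-+-≥ b Y (suc j) m₀ ⟩
      blockStart b Y (suc j + m₀)    ≡⟨ cong (blockStart b Y) (+-suc j m₀) ⟨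
      blockStart b Y (j + suc m₀)    <⟨ φj+m<E ⟩
      E                              ∎)
      where open ≤-Reasoning

  descend : ∀ {i p L} → 1 ≤ p → p + p < L → HasPeriod p Y i (i + L) → Descent b Y i p L
  descend p≥1 2p<L per = descend-aligned p≥1 per (align p≥1 2p<L per)

module _ {d : ℕ} where

  everyLetter-drop : ∀ {D : ℕ → Fin d} k → EveryLetterInfinitelyOften D → EveryLetterInfinitelyOften (drop k D)
  everyLetter-drop zero    everyLetter = everyLetter
  everyLetter-drop {D} (suc k) everyLetter = everyLetter-drop k once
    where
    once : EveryLetterInfinitelyOften (drop 1 D)
    once c n with everyLetter c (suc n)
    ... | suc m , s≤s n≤m , Dm≡c = m , n≤m , Dm≡c

  σ-comp-head : ∀ (D : ℕ → Fin d) n a → ∃ λ r → σ-comp D n (a ∷ []) ≡ a ∷ r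
  σ-comp-head D zero    a = σ-head a []
  σ-comp-head D (suc n) a with σ-comp-head (drop 1 D) n a
  ... | r , eq rewrite eq = σ-head a r

  σ-comp-length-< : ∀ k (D : ℕ → Fin d) n {a} → D k ≢ a →
    length (σ-comp (drop (suc k) D) n (a ∷ [])) < length (σ-comp D (suc k + n) (a ∷ []))
  σ-comp-length-< zero    D n {a} D0≢a with σ-comp-head (drop 1 D) n a
  ... | r , eq rewrite eq = length-σ-∷ r (λ a≡D0 → D0≢a (sym a≡D0))
  σ-comp-length-< (suc k) D n {a} Dk≢a =
    <-≤-trans (σ-comp-length-< k (drop 1 D) n Dk≢a) (length-σ-≥ {b = D 0} (σ-comp (drop 1 D) (suc k + n) (a ∷ [])))

  σ-comp-unbounded : ∀ {D : ℕ → Fin d} {a c} → c ≢ a → EveryLetterInfinitelyOften D →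
    ∀ m → ∃ λ n → m ≤ length (σ-comp D n (a ∷ []))
  σ-comp-unbounded c≢a everyLetter zero = 0 , z≤n
  σ-comp-unbounded {D} {a} {c} c≢a everyLetter (suc m) with everyLetter c 0
  ... | k , _ , Dk≡c with σ-comp-unbounded c≢a (everyLetter-drop (suc k) everyLetter) m
  ...   | n , m≤ = suc k + n , <-≤-trans (s≤s m≤) (σ-comp-length-< k D n (λ Dk≡a → c≢a (trans (sym Dk≡c) Dk≡a)))

  blockStart-suc-drop : ∀ (b : Fin d) Y k →
    blockStart b Y (suc k) ≡ blockLength b (Y 0) + blockStart b (drop (blockLength b (Y 0)) Y) k
  blockStart-suc-drop b Y zero    = sym (+-identityʳ _)
  blockStart-suc-drop b Y (suc k) = trans (cong (λ s → s + blockLength b (Y s)) (blockStart-suc-drop b Y k)) (+-assoc (blockLength b (Y 0)) _ _)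

  σ-prefix-desub : ∀ {b : Fin d} v {Y} → IsPrefix (σ b v) Y → IsPrefix v (desub b Y)
  σ-prefix-desub []      _    = refl
  σ-prefix-desub {b} (c ∷ v) {Y} cv⊑Y = cong₂ _∷_ Y0≡c (trans (take-cong (length v) desub-suc) v⊑desub)
    where
    Y0≡c : Y 0 ≡ c
    Y0≡c = ∷-injectiveˡ (subst (λ u → take (length u) Y ≡ u) (proj₂ (σ-head c v)) cv⊑Y)
    desub-suc : ∀ k → desub b Y (suc k) ≡ desub b (drop (blockLength b (Y 0)) Y) k
    desub-suc k = cong Y (blockStart-suc-drop b Y k)
    v⊑desub : IsPrefix v (desub b (drop (blockLength b (Y 0)) Y))
    v⊑desub = subst (λ e → IsPrefix v (desub b (drop (blockLength b e) Y))) (sym Y0≡c)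
                    (σ-prefix-desub v (proj₂ (IsPrefix-++⁻ (σ-letter b c) cv⊑Y)))

  module _ {D : ℕ → Fin d} {a : Fin d} {Y : InfWord d} where

    limit-desub : IsLimitWord D a Y → IsLimitWord (drop 1 D) a (desub (D 0) Y)
    limit-desub limit n = σ-prefix-desub (σ-comp (drop 1 D) n (a ∷ [])) (limit (suc n))

    limit-desubstitutable : ∀ {c} → c ≢ a → EveryLetterInfinitelyOften D → IsLimitWord D a Y → Desubstitutable (D 0) Y
    limit-desubstitutable c≢a everyLetter limit {x} Yx≢D0 with σ-comp-unbounded c≢a everyLetter (2 + x)
    ... | zero  , long = σ-prefix-followed (a ∷ []) (limit 0) long Yx≢D0
    ... | suc n , long = σ-prefix-followed (σ-comp (drop 1 D) n (a ∷ [])) (limit (suc n)) long Yx≢D0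

DesubstitutableAt : ∀ {d} → (ℕ → Fin d) → InfWord d → ℕ → Set
DesubstitutableAt D Y zero    = Desubstitutable (D 0) Y
DesubstitutableAt D Y (suc n) = DesubstitutableAt (drop 1 D) (desub (D 0) Y) n

limit-desubstitutableAt : ∀ {d} {D : ℕ → Fin d} {a c Y} → c ≢ a → EveryLetterInfinitelyOften D → IsLimitWord D a Y →
  ∀ n → DesubstitutableAt D Y n
limit-desubstitutableAt c≢a everyLetter limit zero    = limit-desubstitutable c≢a everyLetter limit
limit-desubstitutableAt c≢a everyLetter limit (suc n) =
  limit-desubstitutableAt c≢a (everyLetter-drop 1 everyLetter) (limit-desub limit) n

-- At level n, ℓ c is the length of σ_{D 0} ∘ ⋯ ∘ σ_{D (n-1)}(c) and Λ the total weight cut off by align.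
LossBoundedAt : ∀ {d} → ℕ → (ℕ → Fin d) → (Fin d → ℕ) → ℕ → ℕ → Set
LossBoundedAt M D ℓ Λ zero    = ∀ c → Λ ≤ M * ℓ c
LossBoundedAt M D ℓ Λ (suc n) = LossBoundedAt M (drop 1 D) (imageWeight (D 0) ℓ) (Λ + ℓ (D 0)) n

-- e is the last letter applied and r the length of its current run.
record LossInvariant {d} (ℓ : Fin d → ℕ) (Λ : ℕ) (e : Fin d) (r : ℕ) : Set where
  field
    far  : ∀ c → c ≢ e → Λ ≤ 2 * ℓ c
    near : Λ ≤ (2 + r) * ℓ e
    gap  : ∀ c → c ≢ e → r * ℓ e ≤ ℓ c

RunEndsWithin : ∀ {d} → ℕ → (ℕ → Fin d) → Fin d → ℕ → Set
RunEndsWithin K D e r = ¬ (∀ i → i + r ≤ K → D i ≡ e)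

m≤2*n⇒m+o≤2*[n+o] : ∀ {m} n o → m ≤ 2 * n → m + o ≤ 2 * (n + o)
m≤2*n⇒m+o≤2*[n+o] {m} n o m≤2n = begin
  m + o          ≤⟨ +-mono-≤ m≤2n (m≤m+n o (o + 0)) ⟩
  2 * n + 2 * o  ≡⟨ *-distribˡ-+ 2 n o ⟨
  2 * (n + o)    ∎
  where open ≤-Reasoning

module _ {d : ℕ} {ℓ : Fin d → ℕ} {Λ : ℕ} {e : Fin d} {r : ℕ} where

  lossInvariant-bound : ∀ {K} → LossInvariant ℓ Λ e r → r ≤ K → ∀ c → Λ ≤ (2 + K) * ℓ c
  lossInvariant-bound {K} invariant r≤K c with c ≟ e
  ... | yes refl = ≤-trans (LossInvariant.near invariant) (*-monoˡ-≤ (ℓ c) (+-monoʳ-≤ 2 r≤K))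
  ... | no  c≢e  = ≤-trans (LossInvariant.far invariant c c≢e) (*-monoˡ-≤ (ℓ c) (m≤m+n 2 K))

  lossInvariant-continue : LossInvariant ℓ Λ e r → LossInvariant (imageWeight e ℓ) (Λ + ℓ e) e (suc r)
  lossInvariant-continue invariant = record { far = far′ ; near = near′ ; gap = gap′ }
    where
    open ≤-Reasoning
    open LossInvariant invariant
    far′ : ∀ c → c ≢ e → Λ + ℓ e ≤ 2 * imageWeight e ℓ c
    far′ c c≢e rewrite imageWeight-≢ ℓ c≢e = m≤2*n⇒m+o≤2*[n+o] (ℓ c) (ℓ e) (far c c≢e)
    near′ : Λ + ℓ e ≤ (3 + r) * imageWeight e ℓ e
    near′ rewrite imageWeight-≡ {b = e} ℓ = begin
      Λ + ℓ e              ≡⟨ +-comm Λ (ℓ e) ⟩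
      ℓ e + Λ              ≤⟨ +-monoʳ-≤ (ℓ e) near ⟩
      ℓ e + (2 + r) * ℓ e  ∎
    gap′ : ∀ c → c ≢ e → suc r * imageWeight e ℓ e ≤ imageWeight e ℓ c
    gap′ c c≢e rewrite imageWeight-≡ {b = e} ℓ | imageWeight-≢ ℓ c≢e = begin
      ℓ e + r * ℓ e  ≤⟨ +-monoʳ-≤ (ℓ e) (gap c c≢e) ⟩
      ℓ e + ℓ c      ≡⟨ +-comm (ℓ e) (ℓ c) ⟩
      ℓ c + ℓ e      ∎

  lossInvariant-switch : ∀ {b} → b ≢ e → LossInvariant ℓ Λ e r → LossInvariant (imageWeight b ℓ) (Λ + ℓ b) b 1
  lossInvariant-switch {b} b≢e invariant = record { far = far′ ; near = near′ ; gap = gap′ }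
    where
    open ≤-Reasoning
    open LossInvariant invariant
    far′ : ∀ c → c ≢ b → Λ + ℓ b ≤ 2 * imageWeight b ℓ c
    far′ c c≢b with c ≟ e
    ... | no  c≢e  rewrite imageWeight-≢ ℓ c≢b = m≤2*n⇒m+o≤2*[n+o] (ℓ c) (ℓ b) (far c c≢e)
    ... | yes refl rewrite imageWeight-≢ ℓ c≢b = begin
      Λ + ℓ b                    ≤⟨ +-monoˡ-≤ (ℓ b) near ⟩
      (2 + r) * ℓ c + ℓ b        ≡⟨ cong (_+ ℓ b) (*-distribʳ-+ (ℓ c) 2 r) ⟩
      2 * ℓ c + r * ℓ c + ℓ b    ≤⟨ +-monoˡ-≤ (ℓ b) (+-monoʳ-≤ (2 * ℓ c) (gap b b≢e)) ⟩
      2 * ℓ c + ℓ b + ℓ b        ≡⟨ +-assoc (2 * ℓ c) (ℓ b) (ℓ b) ⟩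
      2 * ℓ c + (ℓ b + ℓ b)      ≡⟨ cong (λ x → 2 * ℓ c + (ℓ b + x)) (+-identityʳ (ℓ b)) ⟨
      2 * ℓ c + 2 * ℓ b          ≡⟨ *-distribˡ-+ 2 (ℓ c) (ℓ b) ⟨
      2 * (ℓ c + ℓ b)            ∎
    near′ : Λ + ℓ b ≤ 3 * imageWeight b ℓ b
    near′ rewrite imageWeight-≡ {b = b} ℓ = begin
      Λ + ℓ b        ≡⟨ +-comm Λ (ℓ b) ⟩
      ℓ b + Λ        ≤⟨ +-monoʳ-≤ (ℓ b) (far b b≢e) ⟩
      ℓ b + 2 * ℓ b  ∎
    gap′ : ∀ c → c ≢ b → 1 * imageWeight b ℓ b ≤ imageWeight b ℓ c
    gap′ c c≢b rewrite imageWeight-≡ {b = b} ℓ | imageWeight-≢ ℓ c≢b =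
      subst (_≤ ℓ c + ℓ b) (sym (+-identityʳ (ℓ b))) (m≤n+m (ℓ b) (ℓ c))

module _ {d : ℕ} {K : ℕ} {D : ℕ → Fin d} where

  runEnds-≤ : ∀ {e r} → RunEndsWithin K D e r → r ≤ K
  runEnds-≤ {r = r} ends with r ≤? K
  ... | yes r≤K = r≤K
  ... | no  r≰K = ⊥-elim (ends λ i i+r≤K → ⊥-elim (r≰K (≤-trans (m≤n+m r i) i+r≤K)))

  runEnds-start : WeakPartialQuotientsBoundedBy D K → RunEndsWithin K D (D 0) 0
  runEnds-start bounded allD0 = bounded 0 λ i i≤K → allD0 i (subst (_≤ K) (sym (+-identityʳ i)) i≤K)

  runEnds-continue : ∀ {r} → RunEndsWithin K D (D 0) r → RunEndsWithin K (drop 1 D) (D 0) (suc r)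
  runEnds-continue {r} ends allD0 = ends λ
    { zero    _        → refl
    ; (suc i) 1+i+r≤K → allD0 i (subst (_≤ K) (sym (+-suc i r)) 1+i+r≤K)
    }

  runEnds-switch : WeakPartialQuotientsBoundedBy D K → RunEndsWithin K (drop 1 D) (D 0) 1
  runEnds-switch bounded allD0 = bounded 0 λ
    { zero    _     → refl
    ; (suc i) 1+i≤K → allD0 i (subst (_≤ K) (+-comm 1 i) 1+i≤K)
    }

lossBoundedAt : ∀ {d K} {D : ℕ → Fin d} {ℓ Λ e r} → WeakPartialQuotientsBoundedBy D K →
  LossInvariant ℓ Λ e r → RunEndsWithin K D e r → ∀ n → LossBoundedAt (2 + K) D ℓ Λ n
lossBoundedAt bounded invariant ends zero = lossInvariant-bound invariant (runEnds-≤ ends)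
lossBoundedAt {D = D} {e = e} bounded invariant ends (suc n) with D 0 ≟ e
... | yes refl = lossBoundedAt (λ k → bounded (suc k)) (lossInvariant-continue invariant) (runEnds-continue ends) n
... | no  D0≢e = lossBoundedAt (λ k → bounded (suc k)) (lossInvariant-switch D0≢e invariant) (runEnds-switch bounded) n

periodicWeight-≤ : ∀ {d} M {L} {D : ℕ → Fin d} {Y ℓ Λ i p} → Acc _<_ L →
  (∀ n → DesubstitutableAt D Y n) → (∀ n → LossBoundedAt M D ℓ Λ n) →
  1 ≤ p → p ≤ L → HasPeriod p Y i (i + L) → Λ + factorWeight ℓ Y i L ≤ (2 + M) * factorWeight ℓ Y i p
periodicWeight-≤ M {L} {D} {Y} {ℓ} {Λ} {i} {p} (acc smaller) desubAt lossAt p≥1 p≤L per with L ≤? p + p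
... | yes L≤2p = begin
  Λ + factorWeight ℓ Y i L  ≤⟨ +-mono-≤ Λ≤Mw (factorWeight-≤-2* ℓ Y per p≤L L≤2p) ⟩
  M * w + 2 * w             ≡⟨ +-comm (M * w) (2 * w) ⟩
  2 * w + M * w             ≡⟨ *-distribʳ-+ w 2 M ⟨
  (2 + M) * w               ∎
  where
  open ≤-Reasoning
  w : ℕ
  w = factorWeight ℓ Y i p
  Λ≤Mw : Λ ≤ M * w
  Λ≤Mw = ≤-trans (lossAt 0 (Y i)) (*-monoʳ-≤ M (factorWeight-head ℓ Y i p≥1))
... | no  L≰2p = begin
  Λ + factorWeight ℓ Y i L                        ≤⟨ +-monoʳ-≤ Λ (window-weight ℓ) ⟩
  Λ + (ℓ (D 0) + factorWeight ℓ′ Y′ origin width)  ≡⟨ +-assoc Λ _ _ ⟨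
  Λ + ℓ (D 0) + factorWeight ℓ′ Y′ origin width    ≤⟨ periodicWeight-≤ M (smaller shorter) (λ n → desubAt (suc n))
                                                       (λ n → lossAt (suc n)) period≥1 period≤width periodic ⟩
  (2 + M) * factorWeight ℓ′ Y′ origin period       ≡⟨ cong ((2 + M) *_) (period-weight ℓ) ⟩
  (2 + M) * factorWeight ℓ Y i p                  ∎
  where
  open ≤-Reasoning
  open Descent (descend (desubAt 0) p≥1 (≰⇒> L≰2p) per)
  ℓ′ : Fin _ → ℕ
  ℓ′ = imageWeight (D 0) ℓ
  Y′ : InfWord _
  Y′ = desub (D 0) Y

module _ {A : Set} (z : List A) where

  pow-suc-snoc : ∀ Q → pow z (suc Q) ≡ pow z Q ++ z
  pow-suc-snoc zero    = ++-identityʳ z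
  pow-suc-snoc (suc Q) = trans (cong (z ++_) (pow-suc-snoc Q)) (sym (++-assoc z (pow z Q) z))

  length-pow : ∀ Q → length (pow z Q) ≡ Q * length z
  length-pow zero    = refl
  length-pow (suc Q) = trans (length-++ z) (cong (length z +_) (length-pow Q))

pow-hasPeriod : ∀ {d} (z : List (Fin d)) Q {y : InfWord d} {i} →
  IsPrefix (pow z (suc Q)) (drop i y) → HasPeriod (length z) y i (i + length (pow z (suc Q)))
pow-hasPeriod z Q {y} {i} z^P⊑y = hasPeriod-intro {Y = y} i _ λ {t} t+p<L →
  trans (IsPrefix-agree unshifted shifted (below t+p<L))
        (cong y (trans (cong (i +_) (+-comm (length z) t)) (sym (+-assoc i t (length z)))))
  where
  shifted : IsPrefix (pow z Q) (drop (length z) (drop i y))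
  shifted = proj₂ (IsPrefix-++⁻ z z^P⊑y)
  unshifted : IsPrefix (pow z Q) (drop i y)
  unshifted = proj₁ (IsPrefix-++⁻ (pow z Q) (subst (λ u → IsPrefix u (drop i y)) (pow-suc-snoc z Q) z^P⊑y))
  below : ∀ {t} → t + length z < length (pow z (suc Q)) → t < length (pow z Q)
  below {t} t+p<L = +-cancelˡ-< (length z) t _ (subst₂ _<_ (+-comm t (length z)) (length-++ z) t+p<L)

limit-powerFree : ∀ {d} {dir : ℕ → Fin d} {a c y K} → c ≢ a → EveryLetterInfinitelyOften dir → IsLimitWord dir a y →
  WeakPartialQuotientsBoundedBy dir K → PowerFree (5 + K) y
limit-powerFree c≢a everyLetter limit bounded [] z≢[] _ = z≢[] refl
limit-powerFree {dir = dir} {y = y} {K} c≢a everyLetter limit bounded z@(_ ∷ _) _ (i , z^P⊑y) =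
  <-irrefl refl (*-cancelʳ-≤ (5 + K) (4 + K) p (begin
    (5 + K) * p                              ≡⟨ length-pow z (5 + K) ⟨
    L                                        ≡⟨ factorWeight-one y i L ⟨
    factorWeight (λ _ → 1) y i L             ≤⟨ periodicWeight-≤ (2 + K) (<-wellFounded L) desubAt lossAt
                                                  (s≤s z≤n) p≤L (pow-hasPeriod z (4 + K) {y} z^P⊑y) ⟩
    (4 + K) * factorWeight (λ _ → 1) y i p   ≡⟨ cong ((4 + K) *_) (factorWeight-one y i p) ⟩
    (4 + K) * p                              ∎))
  where
  open ≤-Reasoning
  p L : ℕ
  p = length z
  L = length (pow z (5 + K))
  p≤L : p ≤ L
  p≤L = subst (p ≤_) (sym (length-pow z (5 + K))) (m≤m+n p _)
  desubAt : ∀ n → DesubstitutableAt dir y n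
  desubAt = limit-desubstitutableAt c≢a everyLetter limit
  -- Before level 0 a run of dir 0 of length 0 has been applied.
  lossAt : ∀ n → LossBoundedAt (2 + K) dir (λ _ → 1) 0 n
  lossAt = lossBoundedAt bounded (record { far = λ _ _ → z≤n ; near = z≤n ; gap = λ _ _ → z≤n }) (runEnds-start bounded)

lemma6p6 : (d : ℕ) → d ≥ 2 → (x : InfWord d) → (dir : ℕ → Fin d) →
    IsArnouxRauzyWithDirective x dir →
    (∃ λ K → WeakPartialQuotientsBoundedBy dir K) →
    ∃ λ P → PowerFree P x
lemma6p6 zero          ()       x dir _ _
lemma6p6 (suc zero)    (s≤s ()) x dir _ _
lemma6p6 (suc (suc d)) _        x dir (everyLetter , a , y , limit , sameFactors) (K , bounded) =
  5 + K , λ z z≢[] z^P∈x → limit-powerFree (punchInᵢ≢i a Fin.zero) everyLetter limit bounded z z≢[]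
                             (proj₁ (sameFactors (pow z (5 + K))) z^P∈x)
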